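{- Let $n\ge 13$, let $Q$ be a query graph on an $n$-element vertex set $V$ with minimum degree at least $n-3$, and suppose the answers $q(x,y)$ to all pairs $xy\in E(Q)$ have been received for some hidden tree on $V$. Then for any two vertices $a,b$, their distances in any two consistent trees have the same parity.
   Context: The answer $q(x,y)$ to a queried pair is the distance of $x$ and $y$ in the hidden tree. A tree on $V$ is consistent if for every edge $xy$ of $Q$ its distance between $x$ and $y$ equals $q(x,y)$. -}

module Defs where

open import Data.Nat using (ℕ; zero; suc; _≤_; _∸_; _%_)
open import Data.Fin using (Fin)
open import Data.Bool using (Bool; true; false; T; if_then_else_)
open import Data.List using (List; []; _∷_; _++_; [_]; length; map; allFin)
open import Data.Nat.ListAction using (sum)
open import Data.Empty using (⊥)
open import Data.List.Relation.Unary.Linked using (Linked)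
open import Data.List.Relation.Unary.Unique.Propositional using (Unique)
open import Data.Product using (Σ; _×_)
open import Relation.Binary.PropositionalEquality using (_≡_)
open import Relation.Nullary using (¬_)

record Graph (n : ℕ) : Set where
  field
    adj    : Fin n → Fin n → Bool
    sym    : ∀ x y → adj x y ≡ adj y x
    irrefl : ∀ x → adj x x ≡ false

open Graph public

Adj : ∀ {n} → Graph n → Fin n → Fin n → Set
Adj G x y = T (adj G x y)

degree : ∀ {n} → Graph n → Fin n → ℕ
degree {n} G x = sum (map (λ y → if adj G x y then 1 else 0) (allFin n))

data Walk {n : ℕ} (G : Graph n) : Fin n → Fin n → ℕ → Set where
  here : ∀ x → Walk G x x 0
  step : ∀ {x y z k} → Adj G x y → Walk G y z k → Walk G x z (suc k)

Connected : ∀ {n} → Graph n → Set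
Connected G = ∀ x y → Σ ℕ (λ k → Walk G x y k)

IsCycle : ∀ {n} → Graph n → List (Fin n) → Set
IsCycle G []       = ⊥
IsCycle G (x ∷ xs) = (3 ≤ length (x ∷ xs)) × Unique (x ∷ xs) × Linked (Adj G) ((x ∷ xs) ++ [ x ])

Acyclic : ∀ {n} → Graph n → Set
Acyclic G = ∀ vs → ¬ IsCycle G vs

IsTree : ∀ {n} → Graph n → Set
IsTree G = Connected G × Acyclic G

IsDist : ∀ {n} → Graph n → Fin n → Fin n → ℕ → Set
IsDist G x y d = Walk G x y d × (∀ k → Walk G x y k → d ≤ k)

-- T is consistent with the answers of hidden tree H on the query graph Q:
-- for every edge xy of Q, dist_T(x,y) = q(x,y) = dist_H(x,y)
Consistent : ∀ {n} → Graph n → Graph n → Graph n → Set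
Consistent Q H T = ∀ x y → Adj Q x y → ∀ d e → IsDist T x y d → IsDist H x y e → d ≡ e

MinDegreeAtLeast : ∀ {n} → Graph n → ℕ → Set
MinDegreeAtLeast G m = ∀ x → m ≤ degree G x

{-# OPTIONS --safe #-}
module Submission where

-- Two vertices a, b of a graph with n ≥ 7 vertices and minimum degree ≥ n − 3 have a common
-- neighbour c, since their neighbourhoods have more than n elements in total.  Consistency fixes
-- the distances along the query edges ac and cb, so T₁ and T₂ agree on them.  In an acyclic graph
-- every closed walk has even length (a repeated vertex splits it into two shorter closed walks, and
-- one of length ≥ 3 without repetitions would be a cycle), so all a–b walks have the same parity;
-- comparing with the walk through c gives d₁ ≡ d(a,c) + d(c,b) ≡ d₂ (mod 2).

open import Defs hiding (sym)
open import Data.Bool using (Bool; true; false; T; if_then_else_)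
open import Data.Empty using (⊥-elim)
open import Data.Fin using (Fin; _≟_)
open import Data.Fin.Properties using (any?)
open import Data.List using (List; []; _∷_; _++_; [_]; length; map; allFin)
open import Data.List.Properties using (length-tabulate)
open import Data.List.Membership.Propositional using (_∈_)
import Data.List.Membership.DecPropositional as DecMembership
open import Data.List.Relation.Unary.All.Properties.Core using (¬Any⇒All¬)
open import Data.List.Relation.Unary.AllPairs using ([]; _∷_)
open import Data.List.Relation.Unary.Any using (here; there)
open import Data.List.Relation.Unary.Linked using (Linked; [-]; _∷_)
open import Data.List.Relation.Unary.Unique.Propositional using (Unique)
open import Data.Nat using (ℕ; zero; suc; _+_; _*_; _≤_; _<_; _∸_; _%_; z≤n; s≤s)
open import Data.Nat.Divisibility using (_∣_; _∣0; ∣-refl; ∣m∣n⇒∣m+n)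
open import Data.Nat.DivMod using ([m+kn]%n≡m%n; %-remove-+ˡ)
open import Data.Nat.Induction using (<-wellFounded)
open import Data.Nat.ListAction using (sum)
open import Data.Nat.Properties
  using (+-comm; *-comm; +-assoc; +-suc; +-identityʳ; +-commutativeSemigroup; ≤-trans; m≤n⇒m≤1+n;
         +-mono-≤; +-monoˡ-≤; +-monoʳ-<; m≤m+n; m≤n+m; m<m+n; m<n+m; <⇒≱; ≮⇒≥; m<1+n⇒m<n∨m≡n)
open import Algebra.Properties.CommutativeSemigroup +-commutativeSemigroup using (x∙yz≈y∙xz)
open import Data.Product using (Σ; ∃-syntax; _×_; _,_; proj₁; proj₂)
open import Data.Sum using (_⊎_; inj₁; inj₂)
open import Data.Unit using (tt)
open import Induction.WellFounded using (Acc; acc)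
open import Relation.Nullary using (¬_; Dec; yes; no)
open import Relation.Nullary.Decidable using (T?; _×-dec_)
open import Relation.Unary using (Decidable)
open import Relation.Binary.PropositionalEquality
  using (_≡_; refl; sym; trans; cong; cong₂; subst; module ≡-Reasoning)

2∣m+n⇒m%2≡n%2 : ∀ m n → 2 ∣ m + n → m % 2 ≡ n % 2
2∣m+n⇒m%2≡n%2 m n 2∣m+n = begin
  m % 2               ≡⟨ sym ([m+kn]%n≡m%n m n 2) ⟩
  (m + n * 2) % 2     ≡⟨ cong (_% 2) (m+n*2≡[m+n]+n) ⟩
  (m + n + n) % 2     ≡⟨ %-remove-+ˡ n 2∣m+n ⟩
  n % 2               ∎
  where
  open ≡-Reasoning
  m+n*2≡[m+n]+n : m + n * 2 ≡ m + n + n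
  m+n*2≡[m+n]+n = trans (cong (m +_) (*-comm n 2))
                        (trans (cong (λ k → m + (n + k)) (+-identityʳ n)) (sym (+-assoc m n n)))

n<[n∸3]+[n∸3] : ∀ {n} → 7 ≤ n → n < (n ∸ 3) + (n ∸ 3)
n<[n∸3]+[n∸3] {suc (suc (suc m))} (s≤s (s≤s (s≤s 4≤m))) = +-monoˡ-≤ m 4≤m

module _ {P : ℕ → Set} (P? : Decidable P) where

  least-from : ∀ i m → (∀ j → j < i → ¬ P j) → P (i + m) → ∃[ l ] P l × (∀ j → P j → l ≤ j)
  least-from i m below p with P? i
  ... | yes pᵢ = i , pᵢ , λ j pⱼ → ≮⇒≥ (λ j<i → below j j<i pⱼ)
  least-from i zero below p | no ¬pᵢ = ⊥-elim (¬pᵢ (subst P (+-identityʳ i) p))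
  least-from i (suc m) below p | no ¬pᵢ = least-from (suc i) m below′ (subst P (+-suc i m) p)
    where
    below′ : ∀ j → j < suc i → ¬ P j
    below′ j j<1+i with m<1+n⇒m<n∨m≡n j<1+i
    ... | inj₁ j<i  = below j j<i
    ... | inj₂ refl = ¬pᵢ

  least : ∀ {k} → P k → ∃[ l ] P l × (∀ j → P j → l ≤ j)
  least {k} = least-from 0 k (λ _ ())

module _ {n : ℕ} {G : Graph n} where

  open DecMembership (_≟_ {n}) using (_∈?_)

  adj-sym : ∀ {x y} → Adj G x y → Adj G y x
  adj-sym {x} {y} = subst T (Graph.sym G x y)

  adj-irrefl : ∀ {x} → ¬ Adj G x x
  adj-irrefl {x} = subst T (irrefl G x)

  infixr 5 _++ʷ_

  _++ʷ_ : ∀ {x y z k l} → Walk G x y k → Walk G y z l → Walk G x z (k + l)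
  here _   ++ʷ v = v
  step a w ++ʷ v = step a (w ++ʷ v)

  reverse : ∀ {x y k} → Walk G x y k → Walk G y x k
  reverse (here x) = here x
  reverse (step {k = k} a w) = subst (Walk G _ _) (+-comm k 1) (reverse w ++ʷ step (adj-sym a) (here _))

  vertices : ∀ {x y k} → Walk G x y k → List (Fin n)
  vertices (here _)            = []
  vertices (step {x = x} _ w) = x ∷ vertices w

  vertices-linked : ∀ {x y k} (w : Walk G x y k) → Linked (Adj G) (vertices w ++ [ y ])
  vertices-linked (here _)            = [-]
  vertices-linked (step a (here _))   = a ∷ [-]
  vertices-linked (step a (step b w)) = a ∷ vertices-linked (step b w)

  data Through (u x y : Fin n) : ℕ → Set where
    through : ∀ {k l} → Walk G u x k → Walk G x y (suc l) → Through u x y (k + suc l)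

  split-at : ∀ {u x y k} (w : Walk G u y k) → x ∈ vertices w → Through u x y k
  split-at (step a w) (here refl) = through (here _) (step a w)
  split-at (step a w) (there x∈w) with split-at w x∈w
  ... | through p s = through (step a p) s

  data Detour (x y : Fin n) : ℕ → Set where
    detour : ∀ {v k l m} → Walk G x v k → Walk G v v (suc l) → Walk G v y (suc m) →
             Detour x y (k + (suc l + suc m))

  unique⊎detour : ∀ {x y k} (w : Walk G x y k) → Unique (vertices w) ⊎ Detour x y k
  unique⊎detour (here _) = inj₁ []
  unique⊎detour (step {x = x} a w) with unique⊎detour w
  ... | inj₂ (detour p c s) = inj₂ (detour (step a p) c s)
  ... | inj₁ u with x ∈? vertices w
  ...   | no x∉w  = inj₁ (¬Any⇒All¬ (vertices w) x∉w ∷ u)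
  ...   | yes x∈w with split-at w x∈w
  ...     | through p s = inj₂ (detour (here x) (step a p) s)

  unique-closed-walk-even : Acyclic G → ∀ {x k} (w : Walk G x x k) → Unique (vertices w) → 2 ∣ k
  unique-closed-walk-even _ (here _) _                     = 2 ∣0
  unique-closed-walk-even _ (step a (here _)) _            = ⊥-elim (adj-irrefl a)
  unique-closed-walk-even _ (step _ (step _ (here _))) _   = ∣-refl
  unique-closed-walk-even acyclic w@(step _ (step _ (step _ _))) u =
    ⊥-elim (acyclic (vertices w) (s≤s (s≤s (s≤s z≤n)) , u , vertices-linked w))

  closed-walk-even-acc : Acyclic G → ∀ {x k} → Acc _<_ k → Walk G x x k → 2 ∣ k
  closed-walk-even-acc acyclic _ w with unique⊎detour w
  ... | inj₁ u = unique-closed-walk-even acyclic w u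
  closed-walk-even-acc acyclic (acc rs) w | inj₂ (detour {k = k} {l} {m} p c s) =
    subst (2 ∣_) (x∙yz≈y∙xz (suc l) k (suc m))
      (∣m∣n⇒∣m+n (closed-walk-even-acc acyclic (rs loop<) c)
                 (closed-walk-even-acc acyclic (rs rest<) (p ++ʷ s)))
    where
    loop< : suc l < k + (suc l + suc m)
    loop< = ≤-trans (m<m+n (suc l) (s≤s z≤n)) (m≤n+m (suc l + suc m) k)
    rest< : k + suc m < k + (suc l + suc m)
    rest< = +-monoʳ-< k (m<n+m (suc m) (s≤s z≤n))

  closed-walk-even : Acyclic G → ∀ {x k} → Walk G x x k → 2 ∣ k
  closed-walk-even acyclic = closed-walk-even-acc acyclic (<-wellFounded _)

  walk-parity : Acyclic G → ∀ {x y k l} → Walk G x y k → Walk G x y l → k % 2 ≡ l % 2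
  walk-parity acyclic {k = k} {l} w v = 2∣m+n⇒m%2≡n%2 k l (closed-walk-even acyclic (w ++ʷ reverse v))

walk? : ∀ {n} (G : Graph n) k x y → Dec (Walk G x y k)
walk? G zero x y with x ≟ y
... | yes refl = yes (here x)
... | no x≢y   = no λ { (here _) → x≢y refl }
walk? G (suc k) x y with any? (λ z → T? (adj G x z) ×-dec walk? G k z y)
... | yes (z , a , w) = yes (step a w)
... | no ¬w           = no λ { (step a w) → ¬w (_ , a , w) }

shortest-walk : ∀ {n} {G : Graph n} → Connected G → ∀ x y → Σ ℕ (IsDist G x y)
shortest-walk {G = G} connected x y = least (λ k → walk? G k x y) (proj₂ (connected x y))

dist : ∀ {n} {G : Graph n} → Connected G → Fin n → Fin n → ℕ
dist connected x y = proj₁ (shortest-walk connected x y)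

dist-isDist : ∀ {n} {G : Graph n} (connected : Connected G) x y → IsDist G x y (dist connected x y)
dist-isDist connected x y = proj₂ (shortest-walk connected x y)

dist-parity-via : ∀ {n} {G : Graph n} → Acyclic G → (connected : Connected G) →
                  ∀ {x y k} → Walk G x y k → ∀ z → k % 2 ≡ (dist connected x z + dist connected z y) % 2
dist-parity-via acyclic connected {x} {y} w z =
  walk-parity acyclic w (proj₁ (dist-isDist connected x z) ++ʷ proj₁ (dist-isDist connected z y))

countTrue : {A : Set} → (A → Bool) → List A → ℕ
countTrue f xs = sum (map (λ x → if f x then 1 else 0) xs)

countTrue-disjoint : {A : Set} (f g : A → Bool) (xs : List A) → (∀ x → T (f x) → ¬ T (g x)) →
                     countTrue f xs + countTrue g xs ≤ length xs
countTrue-disjoint f g [] _ = z≤n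
countTrue-disjoint f g (x ∷ xs) disjoint with f x in fx | g x in gx
... | true  | true  = ⊥-elim (disjoint x (subst T (sym fx) tt) (subst T (sym gx) tt))
... | true  | false = s≤s (countTrue-disjoint f g xs disjoint)
... | false | false = m≤n⇒m≤1+n (countTrue-disjoint f g xs disjoint)
... | false | true  rewrite +-suc (countTrue f xs) (countTrue g xs) =
  s≤s (countTrue-disjoint f g xs disjoint)

common-neighbour : ∀ {n} (G : Graph n) x y → n < degree G x + degree G y → ∃[ z ] Adj G x z × Adj G z y
common-neighbour {n} G x y n<deg with any? (λ z → T? (adj G x z) ×-dec T? (adj G z y))
... | yes found = found
... | no none = ⊥-elim (<⇒≱ n<deg (subst (degree G x + degree G y ≤_) (length-tabulate {n = n} (λ z → z))
                                      (countTrue-disjoint (adj G x) (adj G y) (allFin n) disjoint)))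
  where
  disjoint : ∀ z → Adj G x z → ¬ Adj G y z
  disjoint z xz yz = none (z , xz , adj-sym {G = G} yz)

dense-common-neighbour : ∀ {n} (G : Graph n) → 7 ≤ n → MinDegreeAtLeast G (n ∸ 3) →
                         ∀ x y → ∃[ z ] Adj G x z × Adj G z y
dense-common-neighbour G 7≤n δG x y =
  common-neighbour G x y (≤-trans (n<[n∸3]+[n∸3] 7≤n) (+-mono-≤ (δG x) (δG y)))

consistent-dist-agree : ∀ {n} {Q H T₁ T₂ : Graph n} → Connected H → Consistent Q H T₁ → Consistent Q H T₂ →
                        ∀ {x y d₁ d₂} → Adj Q x y → IsDist T₁ x y d₁ → IsDist T₂ x y d₂ → d₁ ≡ d₂
consistent-dist-agree H-connected T₁∼H T₂∼H {x} {y} xy dist₁ dist₂ =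
  trans (T₁∼H x y xy _ _ dist₁ (dist-isDist H-connected x y))
        (sym (T₂∼H x y xy _ _ dist₂ (dist-isDist H-connected x y)))

lemma2p7 : (n : ℕ) → 13 ≤ n → (Q : Graph n) → MinDegreeAtLeast Q (n ∸ 3) → (H : Graph n) → IsTree H → (T₁ T₂ : Graph n) → IsTree T₁ → IsTree T₂ → Consistent Q H T₁ → Consistent Q H T₂ → (a b : Fin n) → (d₁ d₂ : ℕ) → IsDist T₁ a b d₁ → IsDist T₂ a b d₂ → d₁ % 2 ≡ d₂ % 2
lemma2p7 n 13≤n Q δQ H (H-connected , _) T₁ T₂ (T₁-connected , T₁-acyclic) (T₂-connected , T₂-acyclic)
         T₁∼H T₂∼H a b d₁ d₂ (a⇝₁b , _) (a⇝₂b , _)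
  with c , Qac , Qcb ← dense-common-neighbour Q (≤-trans (m≤m+n 7 6) 13≤n) δQ a b =
  begin
    d₁ % 2                                               ≡⟨ dist-parity-via T₁-acyclic T₁-connected a⇝₁b c ⟩
    (dist T₁-connected a c + dist T₁-connected c b) % 2  ≡⟨ cong₂ (λ e f → (e + f) % 2) (agree Qac) (agree Qcb) ⟩
    (dist T₂-connected a c + dist T₂-connected c b) % 2  ≡⟨ dist-parity-via T₂-acyclic T₂-connected a⇝₂b c ⟨
    d₂ % 2                                               ∎
  where
  open ≡-Reasoning
  agree : ∀ {x y} → Adj Q x y → dist T₁-connected x y ≡ dist T₂-connected x y
  agree xy = consistent-dist-agree {Q = Q} H-connected T₁∼H T₂∼H xy (dist-isDist T₁-connected _ _) (dist-isDist T₂-connected _ _)
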